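{- Let $\mathcal{D}$ be a symmetric $2$-$(35,17,8)$ design and let $\sigma$ be an automorphism of $\mathcal{D}$ of order $2$. Let $f$ be the number of points of $\mathcal{D}$ fixed by $\sigma$. Then $f \notin \{13,17\}$.
   Context: A symmetric $2$-$(v,k,\lambda)$ design $\mathcal{D}=(\mathcal{P},\mathcal{B})$ consists of a set $\mathcal{P}$ of $v$ points and a set $\mathcal{B}$ of $v$ blocks, each block a $k$-subset of $\mathcal{P}$, such that every pair of distinct points lies in exactly $\lambda$ blocks. An automorphism of $\mathcal{D}$ is a permutation of $\mathcal{P}$ mapping blocks to blocks. -}

module Defs where

open import Data.Nat using (ℕ)
open import Data.Bool using (Bool; _∧_)
open import Data.Fin using (Fin; _≟_)
open import Data.Fin.Subset using (Subset; ∣_∣)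
open import Data.Vec using (lookup; tabulate)
open import Data.Fin.Permutation using (Permutation′; _⟨$⟩ʳ_; _⟨$⟩ˡ_)
open import Data.Product using (∃; Σ)
open import Relation.Nullary using (¬_; does)
open import Relation.Binary.PropositionalEquality using (_≡_; _≢_)

record SymmetricDesign (v k lam : ℕ) : Set where
  field
    block     : Fin v → Subset v
    -- the blocks form a *set* of v blocks: they are pairwise distinct
    distinct  : ∀ i j → block i ≡ block j → i ≡ j
    blockSize : ∀ i → ∣ block i ∣ ≡ k
    pairCount : ∀ p q → p ≢ q →
                ∣ tabulate (λ i → lookup (block i) p ∧ lookup (block i) q) ∣ ≡ lam

open SymmetricDesign public

image : ∀ {v} → Permutation′ v → Subset v → Subset v
image σ B = tabulate (λ q → lookup B (σ ⟨$⟩ˡ q))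

IsAutomorphism : ∀ {v k lam} → SymmetricDesign v k lam → Permutation′ v → Set
IsAutomorphism D σ = ∀ i → ∃ λ j → image σ (block D i) ≡ block D j

HasOrder2 : ∀ {v} → Permutation′ v → Set
HasOrder2 σ = (∀ p → σ ⟨$⟩ʳ (σ ⟨$⟩ʳ p) ≡ p) Data.Product.× (∃ λ p → σ ⟨$⟩ʳ p ≢ p)

fixedPoints : ∀ {v} → Permutation′ v → ℕ
fixedPoints σ = ∣ tabulate (λ p → does (σ ⟨$⟩ʳ p ≟ p)) ∣

-- Counting pairs of points shows that every point lies on k = 17 blocks, and then
-- ∑ⱼ (|Bᵢ ∩ Bⱼ| − 8)² = (17 − 8)² is already the term j = i, so any two blocks meet
-- in 8 points.  The involution σ permutes the blocks by an involution τ.  Call a block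
-- separating for p if it contains exactly one of p and σp: a moved block is separating
-- for 2·9 points and a moved point has 2·9 separating blocks, so τ moves as many blocks
-- as σ moves points, namely 35 − f.
--
-- Fix a moved point y and let Z be the number of moved blocks not separating for y;
-- then Z + 18 = 35 − f.  For a moved point x ∉ {y, σy}, the 9 blocks containing x but
-- not σx split into those containing exactly one of y, σy (as many of each kind, since
-- x meets y and σy in 8 blocks each) and T blocks not separating for y.  So T is odd,
-- and, applying τ, exactly 2T ≤ Z blocks are separating for x but not for y.
-- If f = 17 then Z = 0, so no such x exists and only y and σy move, not 18 points.
-- If f = 13 then Z = 4 forces T = 1, so each of the 35 points has at most 2 separating
-- blocks among those Z, whereas each of the Z blocks is separating for 18 points: 72 > 70.
module Submission where

open import Defs
open import Algebra.Bundles using (CommutativeMonoid)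
open import Data.Bool using (Bool; true; false; _∧_; _∨_; not; _xor_)
open import Data.Bool.Properties
  using (∧-idem; ∧-inverseʳ; ∧-commutativeMonoid; ∨-comm; xor-same; xor-comm)
open import Algebra.Properties.CommutativeSemigroup
  (CommutativeMonoid.commutativeSemigroup ∧-commutativeMonoid)
  using (xy∙z≈xz∙y; xy∙z≈zy∙x)
open import Data.Empty using (⊥-elim)
open import Data.Fin using (Fin; zero; suc; _≟_)
open import Data.Fin.Properties using (suc-injective)
open import Data.Fin.Permutation using (Permutation′; permutation; _⟨$⟩ʳ_; _⟨$⟩ˡ_; inverseˡ)
open import Data.Fin.Subset using (∣_∣)
open import Data.Nat using (ℕ; zero; suc; _+_; _*_; _∸_; _≤_; _<_; z≤n; s≤s; NonZero)
open import Data.Nat.Properties hiding (_≟_; suc-injective)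
open import Data.Nat.Tactic.RingSolver using (solve-∀)
open import Data.Product using (_×_; _,_; proj₁; proj₂; ∃)
open import Data.Sum using (_⊎_; inj₁; inj₂)
open import Data.Vec using (lookup; tabulate)
open import Data.Vec.Properties using (lookup∘tabulate; tabulate∘lookup; tabulate-cong)
open import Function using (_∘_)
open import Relation.Nullary using (does; yes; no)
open import Relation.Nullary.Decidable using (dec-true; dec-false)
open import Relation.Binary.PropositionalEquality
open import Algebra.Properties.Semiring.Sum +-*-semiring
  using (sum; sum-syntax; sum-cong-≗; sum-replicate-zero; ∑-distrib-+; ∑-comm; sum-permute;
         *-distribˡ-sum; *-distribʳ-sum)

-- Indicators of Booleans

⟦_⟧ : Bool → ℕ
⟦ true  ⟧ = 1
⟦ false ⟧ = 0

⟦∧⟧ : ∀ a b → ⟦ a ∧ b ⟧ ≡ ⟦ a ⟧ * ⟦ b ⟧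
⟦∧⟧ true  b = sym (+-identityʳ ⟦ b ⟧)
⟦∧⟧ false b = refl

⟦⟧-idem : ∀ a → ⟦ a ⟧ * ⟦ a ⟧ ≡ ⟦ a ⟧
⟦⟧-idem true  = refl
⟦⟧-idem false = refl

⟦∧⟧*⟦∧⟧ : ∀ a b c d → ⟦ a ∧ b ⟧ * ⟦ c ∧ d ⟧ ≡ ⟦ a ⟧ * ⟦ c ⟧ * ⟦ b ∧ d ⟧
⟦∧⟧*⟦∧⟧ a b c d = begin
  ⟦ a ∧ b ⟧ * ⟦ c ∧ d ⟧           ≡⟨ cong₂ _*_ (⟦∧⟧ a b) (⟦∧⟧ c d) ⟩
  ⟦ a ⟧ * ⟦ b ⟧ * (⟦ c ⟧ * ⟦ d ⟧) ≡⟨ interchange ⟦ a ⟧ ⟦ b ⟧ ⟦ c ⟧ ⟦ d ⟧ ⟩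
  ⟦ a ⟧ * ⟦ c ⟧ * (⟦ b ⟧ * ⟦ d ⟧) ≡⟨ cong (⟦ a ⟧ * ⟦ c ⟧ *_) (⟦∧⟧ b d) ⟨
  ⟦ a ⟧ * ⟦ c ⟧ * ⟦ b ∧ d ⟧       ∎
  where
  open ≡-Reasoning
  interchange : ∀ a b c d → a * b * (c * d) ≡ a * c * (b * d)
  interchange = solve-∀

⟦not⟧+⟦⟧ : ∀ a → ⟦ not a ⟧ + ⟦ a ⟧ ≡ 1
⟦not⟧+⟦⟧ true  = refl
⟦not⟧+⟦⟧ false = refl

⟦∧∧⟧≤ : ∀ a c b → ⟦ (a ∧ c) ∧ b ⟧ ≤ ⟦ a ∧ b ⟧
⟦∧∧⟧≤ false c     b = z≤n
⟦∧∧⟧≤ true  false b = z≤n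
⟦∧∧⟧≤ true  true  b = ≤-refl

⟦⟧-split : ∀ a b → ⟦ a ⟧ ≡ ⟦ a ∧ b ⟧ + ⟦ a ∧ not b ⟧
⟦⟧-split true  true  = refl
⟦⟧-split true  false = refl
⟦⟧-split false b     = refl

⟦xor⟧-split : ∀ a b → ⟦ a xor b ⟧ ≡ ⟦ a ∧ not b ⟧ + ⟦ b ∧ not a ⟧
⟦xor⟧-split true  true  = refl
⟦xor⟧-split true  false = refl
⟦xor⟧-split false true  = refl
⟦xor⟧-split false false = refl

⟦xor∧⟧-split : ∀ a b c → ⟦ (a xor b) ∧ c ⟧ ≡ ⟦ (a ∧ not b) ∧ c ⟧ + ⟦ (b ∧ not a) ∧ c ⟧
⟦xor∧⟧-split true  true  c = refl
⟦xor∧⟧-split true  false c = sym (+-identityʳ ⟦ c ⟧)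
⟦xor∧⟧-split false true  c = refl
⟦xor∧⟧-split false false c = refl

⟦∧xor⟧-split : ∀ a c d → ⟦ a ∧ (c xor d) ⟧ ≡ ⟦ a ∧ (c ∧ not d) ⟧ + ⟦ a ∧ (d ∧ not c) ⟧
⟦∧xor⟧-split true  c d = ⟦xor⟧-split c d
⟦∧xor⟧-split false c d = refl

⟦∧∨⟧-split : ∀ a c d → ⟦ a ∧ (c ∨ d) ⟧ ≡ ⟦ a ∧ c ⟧ + ⟦ a ∧ (d ∧ not c) ⟧
⟦∧∨⟧-split false c     d     = refl
⟦∧∨⟧-split true  true  true  = refl
⟦∧∨⟧-split true  true  false = refl
⟦∧∨⟧-split true  false true  = refl
⟦∧∨⟧-split true  false false = refl

∣tabulate∣≡∑ : ∀ {n} (g : Fin n → Bool) → ∣ tabulate g ∣ ≡ ∑[ p < n ] ⟦ g p ⟧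
∣tabulate∣≡∑ {zero}  g = refl
∣tabulate∣≡∑ {suc n} g with g zero
... | true  = cong suc (∣tabulate∣≡∑ (g ∘ suc))
... | false = ∣tabulate∣≡∑ (g ∘ suc)

-- Finite sums of natural numbers

sum-const : ∀ n c → ∑[ i < n ] c ≡ n * c
sum-const zero    c = refl
sum-const (suc n) c = cong (c +_) (sum-const n c)

sum-const-except : ∀ {n} (f : Fin n → ℕ) p c → (∀ q → q ≢ p → f q ≡ c) →
                   sum f + c ≡ n * c + f p
sum-const-except {suc n} f zero c f≡c = begin
  f zero + sum (f ∘ suc) + c
    ≡⟨ cong (λ s → f zero + s + c) (trans (sum-cong-≗ (λ q → f≡c (suc q) λ ())) (sum-const n c)) ⟩
  f zero + n * c + c
    ≡⟨ reverse (f zero) (n * c) c ⟩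
  suc n * c + f zero ∎
  where
  open ≡-Reasoning
  reverse : ∀ a b c → a + b + c ≡ c + b + a
  reverse = solve-∀
sum-const-except {suc n} f (suc p) c f≡c = begin
  f zero + sum (f ∘ suc) + c
    ≡⟨ +-assoc (f zero) _ c ⟩
  f zero + (sum (f ∘ suc) + c)
    ≡⟨ cong₂ _+_ (f≡c zero λ ())
                 (sum-const-except (f ∘ suc) p c λ q q≢p → f≡c (suc q) (q≢p ∘ suc-injective)) ⟩
  c + (n * c + f (suc p))
    ≡⟨ +-assoc c _ _ ⟨
  suc n * c + f (suc p) ∎
  where open ≡-Reasoning

∑-select : ∀ {n} (f : Fin n → ℕ) p → ∑[ q < n ] (f q * ⟦ does (p ≟ q) ⟧) ≡ f p
∑-select {n} f p = begin
  ∑[ q < n ] (f q * ⟦ does (p ≟ q) ⟧)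
    ≡⟨ +-identityʳ _ ⟨
  ∑[ q < n ] (f q * ⟦ does (p ≟ q) ⟧) + 0
    ≡⟨ sum-const-except _ p 0 off-p ⟩
  n * 0 + f p * ⟦ does (p ≟ p) ⟧
    ≡⟨ cong₂ (λ z b → z + f p * ⟦ b ⟧) (*-zeroʳ n) (dec-true (p ≟ p) refl) ⟩
  f p * 1
    ≡⟨ *-identityʳ (f p) ⟩
  f p ∎
  where
  open ≡-Reasoning
  off-p : ∀ q → q ≢ p → f q * ⟦ does (p ≟ q) ⟧ ≡ 0
  off-p q q≢p with p ≟ q
  ... | yes p≡q = ⊥-elim (q≢p (sym p≡q))
  ... | no _    = *-zeroʳ (f q)

∑-indicator : ∀ {n} (p : Fin n) → ∑[ q < n ] ⟦ does (p ≟ q) ⟧ ≡ 1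
∑-indicator p = trans (sum-cong-≗ (λ q → sym (*-identityˡ ⟦ does (p ≟ q) ⟧))) (∑-select (λ _ → 1) p)

∑-mono-≤ : ∀ {n} {f g : Fin n → ℕ} → (∀ i → f i ≤ g i) → sum f ≤ sum g
∑-mono-≤ {zero}  f≤g = z≤n
∑-mono-≤ {suc n} f≤g = +-mono-≤ (f≤g zero) (∑-mono-≤ (f≤g ∘ suc))

term≤sum : ∀ {n} (f : Fin n → ℕ) i → f i ≤ sum f
term≤sum f zero    = m≤m+n (f zero) _
term≤sum f (suc i) = ≤-trans (term≤sum (f ∘ suc) i) (m≤n+m _ (f zero))

sum≤term⇒others≡0 : ∀ {n} (f : Fin n → ℕ) i → sum f ≤ f i → ∀ j → j ≢ i → f j ≡ 0
sum≤term⇒others≡0 f zero    ∑≤ zero    j≢i = ⊥-elim (j≢i refl)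
sum≤term⇒others≡0 f zero    ∑≤ (suc j) j≢i = n≤0⇒n≡0 (≤-trans (term≤sum (f ∘ suc) j)
  (+-cancelˡ-≤ (f zero) (sum (f ∘ suc)) 0 (subst (f zero + sum (f ∘ suc) ≤_) (sym (+-identityʳ _)) ∑≤)))
sum≤term⇒others≡0 f (suc i) ∑≤ zero    j≢i = n≤0⇒n≡0 (+-cancelʳ-≤ (sum (f ∘ suc)) (f zero) 0
  (≤-trans ∑≤ (term≤sum (f ∘ suc) i)))
sum≤term⇒others≡0 f (suc i) ∑≤ (suc j) j≢i =
  sum≤term⇒others≡0 (f ∘ suc) i (≤-trans (m≤n+m _ (f zero)) ∑≤) j (j≢i ∘ cong suc)

∑-+ : ∀ {n} {f g h : Fin n → ℕ} → (∀ i → f i ≡ g i + h i) → sum f ≡ sum g + sum h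
∑-+ {g = g} {h} split = trans (sum-cong-≗ split) (∑-distrib-+ g h)

∑-split : ∀ {n} (a b : Fin n → Bool) →
          ∑[ i < n ] ⟦ a i ⟧ ≡ ∑[ i < n ] ⟦ a i ∧ b i ⟧ + ∑[ i < n ] ⟦ a i ∧ not (b i) ⟧
∑-split a b = ∑-+ (λ i → ⟦⟧-split (a i) (b i))

vanishing : ∀ {n} {f : Fin n → ℕ} → (∀ i → f i ≡ 0) → sum f ≡ 0
vanishing {n} f≡0 = trans (sum-cong-≗ f≡0) (sum-replicate-zero n)

sum*sum : ∀ {m n} (f : Fin m → ℕ) (g : Fin n → ℕ) →
          sum f * sum g ≡ ∑[ p < m ] ∑[ q < n ] (f p * g q)
sum*sum f g = trans (*-distribʳ-sum (sum g) f) (sum-cong-≗ (λ p → *-distribˡ-sum (f p) g))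

sum-involution : ∀ {n} (π : Fin n → Fin n) → (∀ i → π (π i) ≡ i) →
                 (f : Fin n → ℕ) → sum (f ∘ π) ≡ sum f
sum-involution π π²≡id f = sym (sum-permute f (permutation π π π²≡id π²≡id))

∑-xor-involution : ∀ {n} (π : Fin n → Fin n) → (∀ i → π (π i) ≡ i) → (g : Fin n → Bool) →
                   ∑[ i < n ] ⟦ g i xor g (π i) ⟧ ≡ 2 * ∑[ i < n ] ⟦ g i ∧ not (g (π i)) ⟧
∑-xor-involution {n} π π²≡id g = begin
  ∑[ i < n ] ⟦ g i xor g (π i) ⟧
    ≡⟨ ∑-+ (λ i → ⟦xor⟧-split (g i) (g (π i))) ⟩
  sum f + ∑[ i < n ] ⟦ g (π i) ∧ not (g i) ⟧
    ≡⟨ cong (sum f +_) (trans (sum-cong-≗ f∘π) (sum-involution π π²≡id f)) ⟩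
  sum f + sum f
    ≡⟨ cong (sum f +_) (+-identityʳ (sum f)) ⟨
  2 * sum f ∎
  where
  open ≡-Reasoning
  f : Fin n → ℕ
  f i = ⟦ g i ∧ not (g (π i)) ⟧
  f∘π : ∀ i → ⟦ g (π i) ∧ not (g i) ⟧ ≡ f (π i)
  f∘π i = cong (λ j → ⟦ g (π i) ∧ not (g j) ⟧) (sym (π²≡id i))

odd⇒nonZero : ∀ n → (∀ m → 2 * m ≢ n) → NonZero n
odd⇒nonZero zero    odd = ⊥-elim (odd 0 refl)
odd⇒nonZero (suc n) odd = _

odd-remainder : ∀ {n} A t → (∀ m → 2 * m ≢ n) → n ≡ 2 * A + t → ∃ λ s → t ≡ suc (2 * s)
odd-remainder A zero          odd n≡ = ⊥-elim (odd A (sym (trans n≡ (+-identityʳ (2 * A)))))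
odd-remainder A (suc zero)    odd n≡ = 0 , refl
odd-remainder A (suc (suc t)) odd n≡ =
  let s , t≡1+2s = odd-remainder (suc A) t odd (trans n≡ (shift A t))
  in suc s , trans (cong (2 +_) t≡1+2s) (double-suc s)
  where
  shift : ∀ A t → 2 * A + (2 + t) ≡ 2 * (1 + A) + t
  shift = solve-∀
  double-suc : ∀ s → 3 + 2 * s ≡ 1 + 2 * (1 + s)
  double-suc = solve-∀

twice-odd<6 : ∀ s → 2 * suc (2 * s) < 6 → 2 * suc (2 * s) ≡ 2
twice-odd<6 zero    _  = refl
twice-odd<6 (suc s) <6 = ⊥-elim (<⇒≱ <6 (subst (6 ≤_) (sym (expand s)) (m≤m+n 6 (4 * s))))
  where
  expand : ∀ s → 2 * (1 + 2 * (1 + s)) ≡ 6 + 4 * s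
  expand = solve-∀

sqDist : ℕ → ℕ → ℕ
sqDist c x = (x ∸ c) * (x ∸ c) + (c ∸ x) * (c ∸ x)

sqDist-identity : ∀ c x → sqDist c x + 2 * c * x ≡ x * x + c * c
sqDist-identity zero    zero    = refl
sqDist-identity zero    (suc x) = cong (_+ 0) (+-identityʳ (suc x * suc x))
sqDist-identity (suc c) zero    = drop-zero (suc c)
  where
  drop-zero : ∀ c → c * c + 2 * c * 0 ≡ c * c
  drop-zero = solve-∀
sqDist-identity (suc c) (suc x) = begin
  sqDist c x + 2 * suc c * suc x           ≡⟨ shift (sqDist c x) c x ⟩
  sqDist c x + 2 * c * x + 2 * (1 + c + x) ≡⟨ cong (_+ 2 * (1 + c + x)) (sqDist-identity c x) ⟩
  x * x + c * c + 2 * (1 + c + x)          ≡⟨ square c x ⟩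
  suc x * suc x + suc c * suc c            ∎
  where
  open ≡-Reasoning
  shift : ∀ d c x → d + 2 * (1 + c) * (1 + x) ≡ d + 2 * c * x + 2 * (1 + c + x)
  shift = solve-∀
  square : ∀ c x → x * x + c * c + 2 * (1 + c + x) ≡ (1 + x) * (1 + x) + (1 + c) * (1 + c)
  square = solve-∀

sqDist-+ : ∀ c m → sqDist c (c + m) ≡ m * m
sqDist-+ zero    m rewrite 0∸n≡0 m = +-identityʳ (m * m)
sqDist-+ (suc c) m = sqDist-+ c m

sqDist≡0⇒≡ : ∀ c x → sqDist c x ≡ 0 → x ≡ c
sqDist≡0⇒≡ zero    zero    _   = refl
sqDist≡0⇒≡ (suc c) (suc x) d≡0 = cong suc (sqDist≡0⇒≡ c x d≡0)

∑-sqDist : ∀ {n} c (f : Fin n → ℕ) →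
           ∑[ j < n ] sqDist c (f j) + 2 * c * sum f ≡ ∑[ j < n ] (f j * f j) + n * (c * c)
∑-sqDist {n} c f = begin
  ∑[ j < n ] sqDist c (f j) + 2 * c * sum f
    ≡⟨ cong (∑[ j < n ] sqDist c (f j) +_) (*-distribˡ-sum (2 * c) f) ⟩
  ∑[ j < n ] sqDist c (f j) + ∑[ j < n ] (2 * c * f j)
    ≡⟨ ∑-+ (λ j → sym (sqDist-identity c (f j))) ⟨
  ∑[ j < n ] (f j * f j + c * c)
    ≡⟨ ∑-distrib-+ (λ j → f j * f j) (λ _ → c * c) ⟩
  ∑[ j < n ] (f j * f j) + ∑[ j < n ] (c * c)
    ≡⟨ cong (∑[ j < n ] (f j * f j) +_) (sum-const n (c * c)) ⟩
  ∑[ j < n ] (f j * f j) + n * (c * c) ∎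
  where open ≡-Reasoning

replication≡block-size : ∀ v k lam r → 2 ≤ k → v * lam + k ≡ lam + k * k →
                         k * r + lam ≡ v * lam + r → r ≡ k
replication≡block-size v (suc (suc m)) lam r (s≤s (s≤s z≤n)) parameters counting =
  *-cancelˡ-≡ r k (suc m) (+-cancelʳ-≡ (lam + (r + k)) _ _ (begin
    suc m * r + (lam + (r + k)) ≡⟨ regroup₁ m r lam ⟩
    k * r + lam + k             ≡⟨ cong (_+ k) counting ⟩
    v * lam + r + k             ≡⟨ regroup₂ (v * lam) r k ⟩
    v * lam + k + r             ≡⟨ cong (_+ r) parameters ⟩
    lam + k * k + r             ≡⟨ regroup₃ m r lam ⟩
    suc m * k + (lam + (r + k)) ∎))
  where
  open ≡-Reasoning
  k = suc (suc m)
  regroup₁ : ∀ m r lam → (1 + m) * r + (lam + (r + (2 + m))) ≡ (2 + m) * r + lam + (2 + m)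
  regroup₁ = solve-∀
  regroup₂ : ∀ a r k → a + r + k ≡ a + k + r
  regroup₂ = solve-∀
  regroup₃ : ∀ m r lam → lam + (2 + m) * (2 + m) + r ≡ (1 + m) * (2 + m) + (lam + (r + (2 + m)))
  regroup₃ = solve-∀

sqDist-total : ∀ v lam μ s → let k = lam + μ in v * lam + k ≡ lam + k * k →
               s + 2 * lam * (k * k) ≡ lam * (k * k) + μ * k + v * (lam * lam) → s ≡ μ * μ
sqDist-total v lam μ s parameters total =
  +-cancelʳ-≡ (2 * lam * (k * k) + lam * k) s (μ * μ) (begin
    s + (2 * lam * (k * k) + lam * k)                 ≡⟨ +-assoc s _ _ ⟨
    s + 2 * lam * (k * k) + lam * k                   ≡⟨ cong (_+ lam * k) total ⟩
    lam * (k * k) + μ * k + v * (lam * lam) + lam * k ≡⟨ factor v lam μ ⟩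
    lam * (k * k) + μ * k + lam * (v * lam + k)       ≡⟨ cong (λ t → lam * (k * k) + μ * k + lam * t) parameters ⟩
    lam * (k * k) + μ * k + lam * (lam + k * k)       ≡⟨ expand lam μ ⟩
    μ * μ + (2 * lam * (k * k) + lam * k)             ∎)
  where
  open ≡-Reasoning
  k = lam + μ
  factor : ∀ v lam μ → lam * ((lam + μ) * (lam + μ)) + μ * (lam + μ) + v * (lam * lam) + lam * (lam + μ)
                     ≡ lam * ((lam + μ) * (lam + μ)) + μ * (lam + μ) + lam * (v * lam + (lam + μ))
  factor = solve-∀
  expand : ∀ lam μ → lam * ((lam + μ) * (lam + μ)) + μ * (lam + μ) + lam * (lam + (lam + μ) * (lam + μ))
                   ≡ μ * μ + (2 * lam * ((lam + μ) * (lam + μ)) + lam * (lam + μ))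
  expand = solve-∀

-- Incidence counts in a design

module Incidence {v k lam} (D : SymmetricDesign v k lam) where

  infix 7 _∈ᵇ_
  _∈ᵇ_ : Fin v → Fin v → Bool
  p ∈ᵇ i = lookup (block D i) p

  replication : Fin v → ℕ
  replication p = ∑[ i < v ] ⟦ p ∈ᵇ i ⟧

  meet : Fin v → Fin v → ℕ
  meet i j = ∑[ p < v ] ⟦ p ∈ᵇ i ∧ p ∈ᵇ j ⟧

  block-size : ∀ i → ∑[ p < v ] ⟦ p ∈ᵇ i ⟧ ≡ k
  block-size i = begin
    ∑[ p < v ] ⟦ p ∈ᵇ i ⟧          ≡⟨ ∣tabulate∣≡∑ (_∈ᵇ i) ⟨
    ∣ tabulate (lookup (block D i)) ∣ ≡⟨ cong ∣_∣ (tabulate∘lookup (block D i)) ⟩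
    ∣ block D i ∣                   ≡⟨ blockSize D i ⟩
    k                               ∎
    where open ≡-Reasoning

  pair-count : ∀ {p q} → p ≢ q → ∑[ i < v ] ⟦ p ∈ᵇ i ∧ q ∈ᵇ i ⟧ ≡ lam
  pair-count {p} {q} p≢q =
    trans (sym (∣tabulate∣≡∑ (λ i → p ∈ᵇ i ∧ q ∈ᵇ i))) (pairCount D p q p≢q)

  meet-self : ∀ i → meet i i ≡ k
  meet-self i = trans (sum-cong-≗ (λ p → cong ⟦_⟧ (∧-idem (p ∈ᵇ i)))) (block-size i)

  block-ext : ∀ {i j} → (∀ p → p ∈ᵇ i ≡ p ∈ᵇ j) → i ≡ j
  block-ext {i} {j} same = distinct D i j
    (trans (sym (tabulate∘lookup (block D i))) (trans (tabulate-cong same) (tabulate∘lookup (block D j))))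

  replication-identity : ∀ p → k * replication p + lam ≡ v * lam + replication p
  replication-identity p = begin
    k * replication p + lam
      ≡⟨ cong (_+ lam) (*-comm k (replication p)) ⟩
    replication p * k + lam
      ≡⟨ cong (_+ lam) (*-distribʳ-sum k (λ i → ⟦ p ∈ᵇ i ⟧)) ⟩
    ∑[ i < v ] (⟦ p ∈ᵇ i ⟧ * k) + lam
      ≡⟨ cong (_+ lam) (sum-cong-≗ λ i → cong (⟦ p ∈ᵇ i ⟧ *_) (sym (block-size i))) ⟩
    ∑[ i < v ] (⟦ p ∈ᵇ i ⟧ * ∑[ q < v ] ⟦ q ∈ᵇ i ⟧) + lam
      ≡⟨ cong (_+ lam) (sum-cong-≗ λ i → *-distribˡ-sum ⟦ p ∈ᵇ i ⟧ (λ q → ⟦ q ∈ᵇ i ⟧)) ⟩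
    ∑[ i < v ] ∑[ q < v ] (⟦ p ∈ᵇ i ⟧ * ⟦ q ∈ᵇ i ⟧) + lam
      ≡⟨ cong (_+ lam) (∑-comm (λ i q → ⟦ p ∈ᵇ i ⟧ * ⟦ q ∈ᵇ i ⟧)) ⟩
    ∑[ q < v ] ∑[ i < v ] (⟦ p ∈ᵇ i ⟧ * ⟦ q ∈ᵇ i ⟧) + lam
      ≡⟨ cong (_+ lam) (sum-cong-≗ λ q → sum-cong-≗ λ i → sym (⟦∧⟧ (p ∈ᵇ i) (q ∈ᵇ i))) ⟩
    ∑[ q < v ] ∑[ i < v ] ⟦ p ∈ᵇ i ∧ q ∈ᵇ i ⟧ + lam
      ≡⟨ sum-const-except _ p lam (λ q q≢p → pair-count (q≢p ∘ sym)) ⟩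
    v * lam + ∑[ i < v ] ⟦ p ∈ᵇ i ∧ p ∈ᵇ i ⟧
      ≡⟨ cong (v * lam +_) (sum-cong-≗ λ i → cong ⟦_⟧ (∧-idem (p ∈ᵇ i))) ⟩
    v * lam + replication p ∎
    where open ≡-Reasoning

  only-first-point : ∀ {p q} → p ≢ q →
                     ∑[ i < v ] ⟦ p ∈ᵇ i ∧ not (q ∈ᵇ i) ⟧ + lam ≡ replication p
  only-first-point {p} {q} p≢q = begin
    ∑[ i < v ] ⟦ p ∈ᵇ i ∧ not (q ∈ᵇ i) ⟧ + lam
      ≡⟨ +-comm _ lam ⟩
    lam + ∑[ i < v ] ⟦ p ∈ᵇ i ∧ not (q ∈ᵇ i) ⟧
      ≡⟨ cong (_+ ∑[ i < v ] ⟦ p ∈ᵇ i ∧ not (q ∈ᵇ i) ⟧) (pair-count p≢q) ⟨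
    ∑[ i < v ] ⟦ p ∈ᵇ i ∧ q ∈ᵇ i ⟧ + ∑[ i < v ] ⟦ p ∈ᵇ i ∧ not (q ∈ᵇ i) ⟧
      ≡⟨ ∑-split (p ∈ᵇ_) (q ∈ᵇ_) ⟨
    replication p ∎
    where open ≡-Reasoning

  only-first-block : ∀ i j → ∑[ p < v ] ⟦ p ∈ᵇ i ∧ not (p ∈ᵇ j) ⟧ + meet i j ≡ k
  only-first-block i j =
    trans (+-comm _ (meet i j)) (trans (sym (∑-split (_∈ᵇ i) (_∈ᵇ j))) (block-size i))

  ∑-meet²-expand : ∀ i →
    ∑[ j < v ] (meet i j * meet i j)
    ≡ ∑[ p < v ] ∑[ q < v ] (⟦ p ∈ᵇ i ⟧ * ⟦ q ∈ᵇ i ⟧ * ∑[ j < v ] ⟦ p ∈ᵇ j ∧ q ∈ᵇ j ⟧)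
  ∑-meet²-expand i = begin
    ∑[ j < v ] (meet i j * meet i j)
      ≡⟨ sum-cong-≗ (λ j → sum*sum (both j) (both j)) ⟩
    ∑[ j < v ] ∑[ p < v ] ∑[ q < v ] (both j p * both j q)
      ≡⟨ ∑-comm (λ j p → ∑[ q < v ] (both j p * both j q)) ⟩
    ∑[ p < v ] ∑[ j < v ] ∑[ q < v ] (both j p * both j q)
      ≡⟨ sum-cong-≗ (λ p → ∑-comm (λ j q → both j p * both j q)) ⟩
    ∑[ p < v ] ∑[ q < v ] ∑[ j < v ] (both j p * both j q)
      ≡⟨ sum-cong-≗ (λ p → sum-cong-≗ λ q → sum-cong-≗ λ j →
           ⟦∧⟧*⟦∧⟧ (p ∈ᵇ i) (p ∈ᵇ j) (q ∈ᵇ i) (q ∈ᵇ j)) ⟩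
    ∑[ p < v ] ∑[ q < v ] ∑[ j < v ] (⟦ p ∈ᵇ i ⟧ * ⟦ q ∈ᵇ i ⟧ * ⟦ p ∈ᵇ j ∧ q ∈ᵇ j ⟧)
      ≡⟨ sum-cong-≗ (λ p → sum-cong-≗ λ q →
           *-distribˡ-sum (⟦ p ∈ᵇ i ⟧ * ⟦ q ∈ᵇ i ⟧) (λ j → ⟦ p ∈ᵇ j ∧ q ∈ᵇ j ⟧)) ⟨
    ∑[ p < v ] ∑[ q < v ] (⟦ p ∈ᵇ i ⟧ * ⟦ q ∈ᵇ i ⟧ * ∑[ j < v ] ⟦ p ∈ᵇ j ∧ q ∈ᵇ j ⟧) ∎
    where
    open ≡-Reasoning
    both : Fin v → Fin v → ℕ
    both j p = ⟦ p ∈ᵇ i ∧ p ∈ᵇ j ⟧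

-- Symmetric designs with λ(v − 1) = k(k − 1), where k = λ + μ

module Symmetric {v lam μ} (D : SymmetricDesign v (lam + μ) lam)
  (parameters : v * lam + (lam + μ) ≡ lam + (lam + μ) * (lam + μ))
  (2≤k : 2 ≤ lam + μ) where

  open Incidence D public

  k : ℕ
  k = lam + μ

  replication≡k : ∀ p → replication p ≡ k
  replication≡k p =
    replication≡block-size v k lam (replication p) 2≤k parameters (replication-identity p)

  pair-count-δ : ∀ p q → ∑[ j < v ] ⟦ p ∈ᵇ j ∧ q ∈ᵇ j ⟧ ≡ lam + μ * ⟦ does (p ≟ q) ⟧
  pair-count-δ p q with p ≟ q
  ... | yes refl = trans (sum-cong-≗ λ j → cong ⟦_⟧ (∧-idem (p ∈ᵇ j)))
                         (trans (replication≡k p) (cong (lam +_) (sym (*-identityʳ μ))))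
  ... | no p≢q   = trans (pair-count p≢q) (sym (trans (cong (lam +_) (*-zeroʳ μ)) (+-identityʳ lam)))

  ∑-meet : ∀ i → ∑[ j < v ] meet i j ≡ k * k
  ∑-meet i = begin
    ∑[ j < v ] ∑[ p < v ] ⟦ p ∈ᵇ i ∧ p ∈ᵇ j ⟧
      ≡⟨ ∑-comm (λ j p → ⟦ p ∈ᵇ i ∧ p ∈ᵇ j ⟧) ⟩
    ∑[ p < v ] ∑[ j < v ] ⟦ p ∈ᵇ i ∧ p ∈ᵇ j ⟧
      ≡⟨ sum-cong-≗ (λ p → sum-cong-≗ λ j → ⟦∧⟧ (p ∈ᵇ i) (p ∈ᵇ j)) ⟩
    ∑[ p < v ] ∑[ j < v ] (⟦ p ∈ᵇ i ⟧ * ⟦ p ∈ᵇ j ⟧)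
      ≡⟨ sum-cong-≗ (λ p → *-distribˡ-sum ⟦ p ∈ᵇ i ⟧ (λ j → ⟦ p ∈ᵇ j ⟧)) ⟨
    ∑[ p < v ] (⟦ p ∈ᵇ i ⟧ * replication p)
      ≡⟨ sum-cong-≗ (λ p → cong (⟦ p ∈ᵇ i ⟧ *_) (replication≡k p)) ⟩
    ∑[ p < v ] (⟦ p ∈ᵇ i ⟧ * k)
      ≡⟨ *-distribʳ-sum k (λ p → ⟦ p ∈ᵇ i ⟧) ⟨
    ∑[ p < v ] ⟦ p ∈ᵇ i ⟧ * k
      ≡⟨ cong (_* k) (block-size i) ⟩
    k * k ∎
    where open ≡-Reasoning

  ∑-meet² : ∀ i → ∑[ j < v ] (meet i j * meet i j) ≡ lam * (k * k) + μ * k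
  ∑-meet² i = begin
    ∑[ j < v ] (meet i j * meet i j)
      ≡⟨ ∑-meet²-expand i ⟩
    ∑[ p < v ] ∑[ q < v ] (⟦ p ∈ᵇ i ⟧ * ⟦ q ∈ᵇ i ⟧ * ∑[ j < v ] ⟦ p ∈ᵇ j ∧ q ∈ᵇ j ⟧)
      ≡⟨ sum-cong-≗ row ⟩
    ∑[ p < v ] (lam * (⟦ p ∈ᵇ i ⟧ * k) + μ * ⟦ p ∈ᵇ i ⟧)
      ≡⟨ ∑-distrib-+ (λ p → lam * (⟦ p ∈ᵇ i ⟧ * k)) (λ p → μ * ⟦ p ∈ᵇ i ⟧) ⟩
    ∑[ p < v ] (lam * (⟦ p ∈ᵇ i ⟧ * k)) + ∑[ p < v ] (μ * ⟦ p ∈ᵇ i ⟧)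
      ≡⟨ cong₂ _+_ (*-distribˡ-sum lam (λ p → ⟦ p ∈ᵇ i ⟧ * k))
                   (*-distribˡ-sum μ (λ p → ⟦ p ∈ᵇ i ⟧)) ⟨
    lam * ∑[ p < v ] (⟦ p ∈ᵇ i ⟧ * k) + μ * ∑[ p < v ] ⟦ p ∈ᵇ i ⟧
      ≡⟨ cong (λ t → lam * t + μ * ∑[ p < v ] ⟦ p ∈ᵇ i ⟧) (*-distribʳ-sum k (λ p → ⟦ p ∈ᵇ i ⟧)) ⟨
    lam * (∑[ p < v ] ⟦ p ∈ᵇ i ⟧ * k) + μ * ∑[ p < v ] ⟦ p ∈ᵇ i ⟧
      ≡⟨ cong (λ t → lam * (t * k) + μ * t) (block-size i) ⟩
    lam * (k * k) + μ * k ∎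
    where
    open ≡-Reasoning
    distribute : ∀ x lam μ d → x * (lam + μ * d) ≡ lam * x + μ * (x * d)
    distribute = solve-∀
    row : ∀ p → ∑[ q < v ] (⟦ p ∈ᵇ i ⟧ * ⟦ q ∈ᵇ i ⟧ * ∑[ j < v ] ⟦ p ∈ᵇ j ∧ q ∈ᵇ j ⟧)
              ≡ lam * (⟦ p ∈ᵇ i ⟧ * k) + μ * ⟦ p ∈ᵇ i ⟧
    row p = begin
      ∑[ q < v ] (x q * ∑[ j < v ] ⟦ p ∈ᵇ j ∧ q ∈ᵇ j ⟧)
        ≡⟨ ∑-+ (λ q → trans (cong (x q *_) (pair-count-δ p q)) (distribute (x q) lam μ _)) ⟩
      ∑[ q < v ] (lam * x q) + ∑[ q < v ] (μ * (x q * ⟦ does (p ≟ q) ⟧))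
        ≡⟨ cong₂ _+_ (*-distribˡ-sum lam x) (*-distribˡ-sum μ (λ q → x q * ⟦ does (p ≟ q) ⟧)) ⟨
      lam * sum x + μ * ∑[ q < v ] (x q * ⟦ does (p ≟ q) ⟧)
        ≡⟨ cong₂ (λ s t → lam * s + μ * t)
                 (sym (*-distribˡ-sum ⟦ p ∈ᵇ i ⟧ (λ q → ⟦ q ∈ᵇ i ⟧))) (∑-select x p) ⟩
      lam * (⟦ p ∈ᵇ i ⟧ * ∑[ q < v ] ⟦ q ∈ᵇ i ⟧) + μ * (⟦ p ∈ᵇ i ⟧ * ⟦ p ∈ᵇ i ⟧)
        ≡⟨ cong₂ (λ s t → lam * (⟦ p ∈ᵇ i ⟧ * s) + μ * t) (block-size i) (⟦⟧-idem (p ∈ᵇ i)) ⟩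
      lam * (⟦ p ∈ᵇ i ⟧ * k) + μ * ⟦ p ∈ᵇ i ⟧ ∎
      where
      x : Fin v → ℕ
      x q = ⟦ p ∈ᵇ i ⟧ * ⟦ q ∈ᵇ i ⟧

  -- ∑ⱼ (meet i j − λ)² = (k − λ)², and the term j = i alone already contributes that much.
  meet≡lam : ∀ {i j} → i ≢ j → meet i j ≡ lam
  meet≡lam {i} {j} i≢j =
    sqDist≡0⇒≡ lam (meet i j)
      (sum≤term⇒others≡0 (sqDist lam ∘ meet i) i (≤-reflexive concentrated) j (i≢j ∘ sym))
    where
    open ≡-Reasoning
    total : ∑[ j < v ] sqDist lam (meet i j) ≡ μ * μ
    total = sqDist-total v lam μ _ parameters (begin
      ∑[ j < v ] sqDist lam (meet i j) + 2 * lam * (k * k)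
        ≡⟨ cong (λ t → ∑[ j < v ] sqDist lam (meet i j) + 2 * lam * t) (∑-meet i) ⟨
      ∑[ j < v ] sqDist lam (meet i j) + 2 * lam * sum (meet i)
        ≡⟨ ∑-sqDist lam (meet i) ⟩
      ∑[ j < v ] (meet i j * meet i j) + v * (lam * lam)
        ≡⟨ cong (_+ v * (lam * lam)) (∑-meet² i) ⟩
      lam * (k * k) + μ * k + v * (lam * lam) ∎)
    concentrated : ∑[ j < v ] sqDist lam (meet i j) ≡ sqDist lam (meet i i)
    concentrated = begin
      ∑[ j < v ] sqDist lam (meet i j) ≡⟨ total ⟩
      μ * μ                            ≡⟨ sqDist-+ lam μ ⟨
      sqDist lam k                     ≡⟨ cong (sqDist lam) (meet-self i) ⟨
      sqDist lam (meet i i)            ∎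

  module Involution (σ : Permutation′ v) (aut : IsAutomorphism D σ)
                    (σ²≡id : ∀ p → σ ⟨$⟩ʳ (σ ⟨$⟩ʳ p) ≡ p) where

    π : Fin v → Fin v
    π p = σ ⟨$⟩ʳ p

    τ : Fin v → Fin v
    τ i = proj₁ (aut i)

    ∈ᵇ-τ : ∀ p i → p ∈ᵇ τ i ≡ π p ∈ᵇ i
    ∈ᵇ-τ p i = begin
      lookup (block D (τ i)) p          ≡⟨ cong (λ B → lookup B p) (proj₂ (aut i)) ⟨
      lookup (image σ (block D i)) p    ≡⟨ lookup∘tabulate (λ q → (σ ⟨$⟩ˡ q) ∈ᵇ i) p ⟩
      (σ ⟨$⟩ˡ p) ∈ᵇ i                   ≡⟨ cong (λ q → (σ ⟨$⟩ˡ q) ∈ᵇ i) (σ²≡id p) ⟨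
      (σ ⟨$⟩ˡ (σ ⟨$⟩ʳ π p)) ∈ᵇ i         ≡⟨ cong (_∈ᵇ i) (inverseˡ σ) ⟩
      π p ∈ᵇ i                          ∎
      where open ≡-Reasoning

    ∈ᵇ-τ-π : ∀ p i → π p ∈ᵇ τ i ≡ p ∈ᵇ i
    ∈ᵇ-τ-π p i = trans (∈ᵇ-τ (π p) i) (cong (_∈ᵇ i) (σ²≡id p))

    τ²≡id : ∀ i → τ (τ i) ≡ i
    τ²≡id i = block-ext λ p → trans (∈ᵇ-τ p (τ i)) (∈ᵇ-τ-π p i)

    isMovedPoint : Fin v → Bool
    isMovedPoint p = not (does (π p ≟ p))

    isMovedBlock : Fin v → Bool
    isMovedBlock i = not (does (τ i ≟ i))

    #movedPoints : ℕ
    #movedPoints = ∑[ p < v ] ⟦ isMovedPoint p ⟧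

    #movedBlocks : ℕ
    #movedBlocks = ∑[ i < v ] ⟦ isMovedBlock i ⟧

    separates : Fin v → Fin v → Bool
    separates i p = p ∈ᵇ i xor π p ∈ᵇ i

    separates-fixedPoint : ∀ {p} → π p ≡ p → ∀ i → separates i p ≡ false
    separates-fixedPoint {p} πp≡p i =
      trans (cong (λ q → p ∈ᵇ i xor q ∈ᵇ i) πp≡p) (xor-same (p ∈ᵇ i))

    separates-fixedBlock : ∀ {i} → τ i ≡ i → ∀ p → separates i p ≡ false
    separates-fixedBlock {i} τi≡i p =
      trans (cong (p ∈ᵇ i xor_) (trans (sym (∈ᵇ-τ p i)) (cong (p ∈ᵇ_) τi≡i))) (xor-same (p ∈ᵇ i))

    separates-π : ∀ i p → separates i (π p) ≡ separates i p
    separates-π i p =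
      trans (cong (λ q → π p ∈ᵇ i xor q ∈ᵇ i) (σ²≡id p)) (xor-comm (π p ∈ᵇ i) (p ∈ᵇ i))

    moved∧separates : ∀ i p → isMovedBlock i ∧ separates i p ≡ separates i p
    moved∧separates i p with τ i ≟ i
    ... | yes τi≡i = sym (separates-fixedBlock τi≡i p)
    ... | no _     = refl

    only-first-point-μ : ∀ {p} → π p ≢ p → ∑[ i < v ] ⟦ p ∈ᵇ i ∧ not (π p ∈ᵇ i) ⟧ ≡ μ
    only-first-point-μ πp≢p = +-cancelʳ-≡ lam _ μ
      (trans (only-first-point (πp≢p ∘ sym)) (trans (replication≡k _) (+-comm lam μ)))

    only-first-block-μ : ∀ {i} → τ i ≢ i → ∑[ p < v ] ⟦ p ∈ᵇ i ∧ not (p ∈ᵇ τ i) ⟧ ≡ μ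
    only-first-block-μ {i} τi≢i = +-cancelʳ-≡ lam _ μ
      (trans (cong (∑[ p < v ] ⟦ p ∈ᵇ i ∧ not (p ∈ᵇ τ i) ⟧ +_) (sym (meet≡lam (τi≢i ∘ sym))))
             (trans (only-first-block i (τ i)) (+-comm lam μ)))

    ∑-separates-points : ∀ i → ∑[ p < v ] ⟦ separates i p ⟧ ≡ 2 * μ * ⟦ isMovedBlock i ⟧
    ∑-separates-points i with τ i ≟ i
    ... | yes τi≡i = trans (vanishing (cong ⟦_⟧ ∘ separates-fixedBlock τi≡i)) (sym (*-zeroʳ (2 * μ)))
    ... | no τi≢i  = begin
      ∑[ p < v ] ⟦ p ∈ᵇ i xor π p ∈ᵇ i ⟧
        ≡⟨ ∑-xor-involution π σ²≡id (_∈ᵇ i) ⟩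
      2 * ∑[ p < v ] ⟦ p ∈ᵇ i ∧ not (π p ∈ᵇ i) ⟧
        ≡⟨ cong (2 *_) (sum-cong-≗ λ p → cong (λ b → ⟦ p ∈ᵇ i ∧ not b ⟧) (∈ᵇ-τ p i)) ⟨
      2 * ∑[ p < v ] ⟦ p ∈ᵇ i ∧ not (p ∈ᵇ τ i) ⟧
        ≡⟨ cong (2 *_) (only-first-block-μ τi≢i) ⟩
      2 * μ
        ≡⟨ *-identityʳ (2 * μ) ⟨
      2 * μ * 1 ∎
      where open ≡-Reasoning

    ∑-separates-blocks : ∀ p → ∑[ i < v ] ⟦ separates i p ⟧ ≡ 2 * μ * ⟦ isMovedPoint p ⟧
    ∑-separates-blocks p with π p ≟ p
    ... | yes πp≡p = trans (vanishing (cong ⟦_⟧ ∘ separates-fixedPoint πp≡p)) (sym (*-zeroʳ (2 * μ)))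
    ... | no πp≢p  = begin
      ∑[ i < v ] ⟦ p ∈ᵇ i xor π p ∈ᵇ i ⟧
        ≡⟨ sum-cong-≗ (λ i → cong (λ b → ⟦ p ∈ᵇ i xor b ⟧) (∈ᵇ-τ p i)) ⟨
      ∑[ i < v ] ⟦ p ∈ᵇ i xor p ∈ᵇ τ i ⟧
        ≡⟨ ∑-xor-involution τ τ²≡id (p ∈ᵇ_) ⟩
      2 * ∑[ i < v ] ⟦ p ∈ᵇ i ∧ not (p ∈ᵇ τ i) ⟧
        ≡⟨ cong (2 *_) (sum-cong-≗ λ i → cong (λ b → ⟦ p ∈ᵇ i ∧ not b ⟧) (∈ᵇ-τ p i)) ⟩
      2 * ∑[ i < v ] ⟦ p ∈ᵇ i ∧ not (π p ∈ᵇ i) ⟧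
        ≡⟨ cong (2 *_) (only-first-point-μ πp≢p) ⟩
      2 * μ
        ≡⟨ *-identityʳ (2 * μ) ⟨
      2 * μ * 1 ∎
      where open ≡-Reasoning

    #movedBlocks≡#movedPoints : .{{NonZero μ}} → #movedBlocks ≡ #movedPoints
    #movedBlocks≡#movedPoints = *-cancelˡ-≡ _ _ (2 * μ) {{m*n≢0 2 μ}} (begin
      2 * μ * #movedBlocks                    ≡⟨ *-distribˡ-sum (2 * μ) (λ i → ⟦ isMovedBlock i ⟧) ⟩
      ∑[ i < v ] (2 * μ * ⟦ isMovedBlock i ⟧) ≡⟨ sum-cong-≗ ∑-separates-points ⟨
      ∑[ i < v ] ∑[ p < v ] ⟦ separates i p ⟧ ≡⟨ ∑-comm (λ i p → ⟦ separates i p ⟧) ⟩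
      ∑[ p < v ] ∑[ i < v ] ⟦ separates i p ⟧ ≡⟨ sum-cong-≗ ∑-separates-blocks ⟩
      ∑[ p < v ] (2 * μ * ⟦ isMovedPoint p ⟧) ≡⟨ *-distribˡ-sum (2 * μ) (λ p → ⟦ isMovedPoint p ⟧) ⟨
      2 * μ * #movedPoints                    ∎)
      where open ≡-Reasoning

    #movedPoints+fixedPoints : #movedPoints + fixedPoints σ ≡ v
    #movedPoints+fixedPoints = begin
      #movedPoints + fixedPoints σ
        ≡⟨ cong (#movedPoints +_) (∣tabulate∣≡∑ (λ p → does (π p ≟ p))) ⟩
      #movedPoints + ∑[ p < v ] ⟦ does (π p ≟ p) ⟧
        ≡⟨ ∑-+ (λ p → sym (⟦not⟧+⟦⟧ (does (π p ≟ p)))) ⟨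
      ∑[ p < v ] 1
        ≡⟨ sum-const v 1 ⟩
      v * 1
        ≡⟨ *-identityʳ v ⟩
      v ∎
      where open ≡-Reasoning

    -- #movedNonsep and #sepNonsep x are the Z and 2T of the opening comment.
    module MovedPoint (y : Fin v) (πy≢y : π y ≢ y) (μ-odd : ∀ m → 2 * m ≢ μ) where

      instance
        μ≢0 : NonZero μ
        μ≢0 = odd⇒nonZero μ μ-odd

      #movedNonsep : ℕ
      #movedNonsep = ∑[ i < v ] ⟦ isMovedBlock i ∧ not (separates i y) ⟧

      #sepNonsep : Fin v → ℕ
      #sepNonsep x = ∑[ i < v ] ⟦ separates i x ∧ not (separates i y) ⟧

      #movedNonsep+2μ : #movedNonsep + 2 * μ ≡ #movedBlocks
      #movedNonsep+2μ = begin
        #movedNonsep + 2 * μ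
          ≡⟨ +-comm #movedNonsep (2 * μ) ⟩
        2 * μ + #movedNonsep
          ≡⟨ cong (_+ #movedNonsep) ∑-separates-y ⟨
        ∑[ i < v ] ⟦ separates i y ⟧ + #movedNonsep
          ≡⟨ cong (_+ #movedNonsep) (sum-cong-≗ λ i → cong ⟦_⟧ (moved∧separates i y)) ⟨
        ∑[ i < v ] ⟦ isMovedBlock i ∧ separates i y ⟧ + #movedNonsep
          ≡⟨ ∑-split isMovedBlock (λ i → separates i y) ⟨
        #movedBlocks ∎
        where
        open ≡-Reasoning
        ∑-separates-y : ∑[ i < v ] ⟦ separates i y ⟧ ≡ 2 * μ
        ∑-separates-y = trans (∑-separates-blocks y)
          (trans (cong (λ b → 2 * μ * ⟦ not b ⟧) (dec-false (π y ≟ y) πy≢y)) (*-identityʳ (2 * μ)))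

      #movedNonsep+2μ+fixedPoints : #movedNonsep + 2 * μ + fixedPoints σ ≡ v
      #movedNonsep+2μ+fixedPoints =
        trans (cong (_+ fixedPoints σ) (trans #movedNonsep+2μ #movedBlocks≡#movedPoints)) #movedPoints+fixedPoints

      #sepNonsep≤#movedNonsep : ∀ x → #sepNonsep x ≤ #movedNonsep
      #sepNonsep≤#movedNonsep x = ∑-mono-≤ λ i →
        subst (λ b → ⟦ b ∧ not (separates i y) ⟧ ≤ _) (moved∧separates i x)
              (⟦∧∧⟧≤ (isMovedBlock i) (separates i x) _)

      ∑-#sepNonsep : ∑[ x < v ] #sepNonsep x ≡ 2 * μ * #movedNonsep
      ∑-#sepNonsep = begin
        ∑[ x < v ] ∑[ i < v ] ⟦ separates i x ∧ keeps i ⟧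
          ≡⟨ ∑-comm (λ x i → ⟦ separates i x ∧ keeps i ⟧) ⟩
        ∑[ i < v ] ∑[ x < v ] ⟦ separates i x ∧ keeps i ⟧
          ≡⟨ sum-cong-≗ (λ i → sum-cong-≗ λ x → ⟦∧⟧ (separates i x) (keeps i)) ⟩
        ∑[ i < v ] ∑[ x < v ] (⟦ separates i x ⟧ * ⟦ keeps i ⟧)
          ≡⟨ sum-cong-≗ (λ i → *-distribʳ-sum ⟦ keeps i ⟧ (λ x → ⟦ separates i x ⟧)) ⟨
        ∑[ i < v ] (∑[ x < v ] ⟦ separates i x ⟧ * ⟦ keeps i ⟧)
          ≡⟨ sum-cong-≗ (λ i → cong (_* ⟦ keeps i ⟧) (∑-separates-points i)) ⟩
        ∑[ i < v ] (2 * μ * ⟦ isMovedBlock i ⟧ * ⟦ keeps i ⟧)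
          ≡⟨ sum-cong-≗ (λ i → trans (*-assoc (2 * μ) _ _)
                                     (cong (2 * μ *_) (sym (⟦∧⟧ (isMovedBlock i) (keeps i))))) ⟩
        ∑[ i < v ] (2 * μ * ⟦ isMovedBlock i ∧ keeps i ⟧)
          ≡⟨ *-distribˡ-sum (2 * μ) (λ i → ⟦ isMovedBlock i ∧ keeps i ⟧) ⟨
        2 * μ * #movedNonsep ∎
        where
        open ≡-Reasoning
        keeps : Fin v → Bool
        keeps i = not (separates i y)

      #sepNonsep-vanishes : ∀ {x} → π x ≡ x ⊎ x ≡ y ⊎ x ≡ π y → #sepNonsep x ≡ 0
      #sepNonsep-vanishes (inj₁ πx≡x) = vanishing λ i →
        cong (λ b → ⟦ b ∧ not (separates i y) ⟧) (separates-fixedPoint πx≡x i)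
      #sepNonsep-vanishes (inj₂ (inj₁ refl)) = vanishing λ i →
        cong ⟦_⟧ (∧-inverseʳ (separates i y))
      #sepNonsep-vanishes (inj₂ (inj₂ refl)) = vanishing λ i →
        cong ⟦_⟧ (trans (cong (_∧ not (separates i y)) (separates-π i y)) (∧-inverseʳ (separates i y)))

      module Profile (x : Fin v) where

        x∈ πx∈ y∈ πy∈ : Fin v → Bool
        x∈  i = x ∈ᵇ i
        πx∈ i = π x ∈ᵇ i
        y∈  i = y ∈ᵇ i
        πy∈ i = π y ∈ᵇ i

        count : (Bool → Bool → Bool → Bool → Bool) → ℕ
        count F = ∑[ i < v ] ⟦ F (x∈ i) (πx∈ i) (y∈ i) (πy∈ i) ⟧

        count-swap : ∀ F → count (λ a b c d → F b a d c) ≡ count F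
        count-swap F = trans (sum-cong-≗ swap) (sum-involution τ τ²≡id _)
          where
          swap : ∀ i → ⟦ F (πx∈ i) (x∈ i) (πy∈ i) (y∈ i) ⟧
                     ≡ ⟦ F (x∈ (τ i)) (πx∈ (τ i)) (y∈ (τ i)) (πy∈ (τ i)) ⟧
          swap i = cong ⟦_⟧ (sym (trans
            (cong₂ (λ a b → F a b (y ∈ᵇ τ i) (π y ∈ᵇ τ i)) (∈ᵇ-τ x i) (∈ᵇ-τ-π x i))
            (cong₂ (F (π x ∈ᵇ i) (x ∈ᵇ i)) (∈ᵇ-τ y i) (∈ᵇ-τ-π y i))))

        A A′ T : ℕ
        A  = count (λ a b c d → (a ∧ not b) ∧ (c ∧ not d))
        A′ = count (λ a b c d → (a ∧ not b) ∧ (d ∧ not c))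
        T  = count (λ a b c d → (a ∧ not b) ∧ not (c xor d))

        #sepNonsep≡2T : #sepNonsep x ≡ 2 * T
        #sepNonsep≡2T = begin
          #sepNonsep x
            ≡⟨ ∑-+ (λ i → ⟦xor∧⟧-split (x∈ i) (πx∈ i) (not (y∈ i xor πy∈ i))) ⟩
          T + count (λ a b c d → (b ∧ not a) ∧ not (c xor d))
            ≡⟨ cong (T +_) (sum-cong-≗ λ i →
                 cong (λ e → ⟦ (πx∈ i ∧ not (x∈ i)) ∧ not e ⟧) (xor-comm (y∈ i) (πy∈ i))) ⟩
          T + count (λ a b c d → (b ∧ not a) ∧ not (d xor c))
            ≡⟨ cong (T +_) (count-swap (λ a b c d → (a ∧ not b) ∧ not (c xor d))) ⟩
          T + T
            ≡⟨ cong (T +_) (+-identityʳ T) ⟨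
          2 * T ∎
          where open ≡-Reasoning

        split-by-πx∈ : ∀ (G : Bool → Bool → Bool) →
                       count (λ a b c d → a ∧ G c d)
                       ≡ count (λ a b c d → (a ∧ G c d) ∧ b) + count (λ a b c d → (a ∧ not b) ∧ G c d)
        split-by-πx∈ G = ∑-+ λ i →
          let g = G (y∈ i) (πy∈ i) in
          trans (⟦⟧-split (x∈ i ∧ g) (πx∈ i))
                (cong (⟦ (x∈ i ∧ g) ∧ πx∈ i ⟧ +_) (cong ⟦_⟧ (xy∙z≈xz∙y (x∈ i) g (not (πx∈ i)))))

        -- x shares λ blocks with y and with πy, and τ matches the remaining blocks
        -- through both x and πx that contain exactly one of y and πy.
        A′≡A : x ≢ y → x ≢ π y → A′ ≡ A
        A′≡A x≢y x≢πy = +-cancelˡ-≡ U A′ A (begin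
          U + A′                              ≡⟨ cong (_+ A′) U≡U′ ⟩
          U′ + A′                             ≡⟨ split-by-πx∈ (λ c d → d ∧ not c) ⟨
          count (λ a b c d → a ∧ (d ∧ not c)) ≡⟨ +-cancelˡ-≡ lam _ _ union-two-ways ⟩
          count (λ a b c d → a ∧ (c ∧ not d)) ≡⟨ split-by-πx∈ (λ c d → c ∧ not d) ⟩
          U + A                               ∎)
          where
          open ≡-Reasoning
          U U′ : ℕ
          U  = count (λ a b c d → (a ∧ (c ∧ not d)) ∧ b)
          U′ = count (λ a b c d → (a ∧ (d ∧ not c)) ∧ b)
          U≡U′ : U ≡ U′
          U≡U′ = sym (trans
            (sum-cong-≗ λ i → cong ⟦_⟧ (xy∙z≈zy∙x (x∈ i) (πy∈ i ∧ not (y∈ i)) (πx∈ i)))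
            (count-swap (λ a b c d → (a ∧ (c ∧ not d)) ∧ b)))
          union-two-ways : lam + count (λ a b c d → a ∧ (d ∧ not c))
                         ≡ lam + count (λ a b c d → a ∧ (c ∧ not d))
          union-two-ways = begin
            lam + count (λ a b c d → a ∧ (d ∧ not c))
              ≡⟨ cong (_+ count (λ a b c d → a ∧ (d ∧ not c))) (pair-count x≢y) ⟨
            count (λ a b c d → a ∧ c) + count (λ a b c d → a ∧ (d ∧ not c))
              ≡⟨ ∑-+ (λ i → ⟦∧∨⟧-split (x∈ i) (y∈ i) (πy∈ i)) ⟨
            count (λ a b c d → a ∧ (c ∨ d))
              ≡⟨ sum-cong-≗ (λ i → cong (λ e → ⟦ x∈ i ∧ e ⟧) (∨-comm (y∈ i) (πy∈ i))) ⟩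
            count (λ a b c d → a ∧ (d ∨ c))
              ≡⟨ ∑-+ (λ i → ⟦∧∨⟧-split (x∈ i) (πy∈ i) (y∈ i)) ⟩
            count (λ a b c d → a ∧ d) + count (λ a b c d → a ∧ (c ∧ not d))
              ≡⟨ cong (_+ count (λ a b c d → a ∧ (c ∧ not d))) (pair-count x≢πy) ⟩
            lam + count (λ a b c d → a ∧ (c ∧ not d)) ∎

        μ≡2A+T : π x ≢ x → x ≢ y → x ≢ π y → μ ≡ 2 * A + T
        μ≡2A+T πx≢x x≢y x≢πy = begin
          μ
            ≡⟨ only-first-point-μ πx≢x ⟨
          count (λ a b c d → a ∧ not b)
            ≡⟨ ∑-+ (λ i → ⟦⟧-split (x∈ i ∧ not (πx∈ i)) (y∈ i xor πy∈ i)) ⟩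
          count (λ a b c d → (a ∧ not b) ∧ (c xor d)) + T
            ≡⟨ cong (_+ T) (∑-+ λ i → ⟦∧xor⟧-split (x∈ i ∧ not (πx∈ i)) (y∈ i) (πy∈ i)) ⟩
          A + A′ + T
            ≡⟨ cong (λ n → A + n + T) (A′≡A x≢y x≢πy) ⟩
          A + A + T
            ≡⟨ cong (λ n → A + n + T) (+-identityʳ A) ⟨
          2 * A + T ∎
          where open ≡-Reasoning

      #sepNonsep-twice-odd : ∀ {x} → π x ≢ x → x ≢ y → x ≢ π y →
                             ∃ λ s → #sepNonsep x ≡ 2 * suc (2 * s)
      #sepNonsep-twice-odd {x} πx≢x x≢y x≢πy =
        let s , T≡1+2s = odd-remainder A T μ-odd (μ≡2A+T πx≢x x≢y x≢πy)
        in s , trans #sepNonsep≡2T (cong (2 *_) T≡1+2s)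
        where open Profile x

      classify : ∀ x → (π x ≡ x ⊎ x ≡ y ⊎ x ≡ π y) ⊎ ∃ λ s → #sepNonsep x ≡ 2 * suc (2 * s)
      classify x with π x ≟ x | x ≟ y | x ≟ π y
      ... | yes πx≡x | _       | _        = inj₁ (inj₁ πx≡x)
      ... | no _     | yes x≡y | _        = inj₁ (inj₂ (inj₁ x≡y))
      ... | no _     | no _    | yes x≡πy = inj₁ (inj₂ (inj₂ x≡πy))
      ... | no πx≢x  | no x≢y  | no x≢πy  = inj₂ (#sepNonsep-twice-odd πx≢x x≢y x≢πy)

      #movedNonsep≡0⇒μ≤1 : #movedNonsep ≡ 0 → μ ≤ 1
      #movedNonsep≡0⇒μ≤1 Z≡0 = *-cancelˡ-≤ 2 (begin
        2 * μ                                     ≤⟨ m≤n+m (2 * μ) #movedNonsep ⟩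
        #movedNonsep + 2 * μ                      ≡⟨ #movedNonsep+2μ ⟩
        #movedBlocks                              ≡⟨ #movedBlocks≡#movedPoints ⟩
        #movedPoints                              ≤⟨ ∑-mono-≤ moved⇒y∨πy ⟩
        ∑[ p < v ] (δ y p + δ (π y) p)            ≡⟨ ∑-distrib-+ (δ y) (δ (π y)) ⟩
        ∑[ p < v ] δ y p + ∑[ p < v ] δ (π y) p   ≡⟨ cong₂ _+_ (∑-indicator y) (∑-indicator (π y)) ⟩
        2                                         ∎)
        where
        open ≤-Reasoning
        δ : Fin v → Fin v → ℕ
        δ p q = ⟦ does (p ≟ q) ⟧
        moved⇒y∨πy : ∀ p → ⟦ isMovedPoint p ⟧ ≤ δ y p + δ (π y) p
        moved⇒y∨πy p with π p ≟ p | y ≟ p | π y ≟ p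
        ... | yes _   | _      | _       = z≤n
        ... | no _    | yes _  | _       = s≤s z≤n
        ... | no _    | no _   | yes _   = s≤s z≤n
        ... | no πp≢p | no y≢p | no πy≢p =
          let s , T≡ = #sepNonsep-twice-odd πp≢p (y≢p ∘ sym) (πy≢p ∘ sym)
          in ⊥-elim (0≢1+n (sym (n≤0⇒n≡0 (subst₂ _≤_ T≡ Z≡0 (#sepNonsep≤#movedNonsep p)))))

      #movedNonsep<6⇒μ*#movedNonsep≤v : #movedNonsep < 6 → μ * #movedNonsep ≤ v
      #movedNonsep<6⇒μ*#movedNonsep≤v Z<6 = *-cancelˡ-≤ 2 (begin
        2 * (μ * #movedNonsep)  ≡⟨ *-assoc 2 μ #movedNonsep ⟨
        2 * μ * #movedNonsep    ≡⟨ ∑-#sepNonsep ⟨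
        ∑[ x < v ] #sepNonsep x ≤⟨ ∑-mono-≤ at-most-2 ⟩
        ∑[ x < v ] 2            ≡⟨ sum-const v 2 ⟩
        v * 2                   ≡⟨ *-comm v 2 ⟩
        2 * v                   ∎)
        where
        open ≤-Reasoning
        at-most-2 : ∀ x → #sepNonsep x ≤ 2
        at-most-2 x with classify x
        ... | inj₁ cases    = subst (_≤ 2) (sym (#sepNonsep-vanishes cases)) z≤n
        ... | inj₂ (s , T≡) =
          ≤-reflexive (trans T≡ (twice-odd<6 s (subst (_< 6) T≡ (≤-<-trans (#sepNonsep≤#movedNonsep x) Z<6))))

lemma1 : (D : SymmetricDesign 35 17 8) (σ : Permutation′ 35) →
    IsAutomorphism D σ → HasOrder2 σ →
    (fixedPoints σ ≢ 13) × (fixedPoints σ ≢ 17)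
lemma1 D σ aut (σ²≡id , y , πy≢y) = fixed≢13 , fixed≢17
  where
  open Symmetric {lam = 8} {μ = 9} D refl (m≤m+n 2 15)
  open Involution σ aut σ²≡id
  open MovedPoint y πy≢y (λ m → even≢odd m 4)

  #movedNonsep≡ : ∀ {f} z → fixedPoints σ ≡ f → z + 18 + f ≡ 35 → #movedNonsep ≡ z
  #movedNonsep≡ {f} z f≡ z+18+f≡35 = +-cancelʳ-≡ 18 _ z (+-cancelʳ-≡ f _ _
    (trans (subst (λ g → #movedNonsep + 18 + g ≡ 35) f≡ #movedNonsep+2μ+fixedPoints) (sym z+18+f≡35)))

  fixed≢17 : fixedPoints σ ≢ 17
  fixed≢17 f≡17 = ≤⇒≯ (#movedNonsep≡0⇒μ≤1 (#movedNonsep≡ 0 f≡17 refl)) (m≤m+n 2 7)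

  fixed≢13 : fixedPoints σ ≢ 13
  fixed≢13 f≡13 = ≤⇒≯ (subst (λ z → 9 * z ≤ 35) Z≡4 (#movedNonsep<6⇒μ*#movedNonsep≤v Z<6)) ≤-refl
    where
    Z≡4 : #movedNonsep ≡ 4
    Z≡4 = #movedNonsep≡ 4 f≡13 refl
    Z<6 : #movedNonsep < 6
    Z<6 = subst (_< 6) (sym Z≡4) (n≤1+n 5)
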